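{- Let $\boldsymbol{\alpha}=(a_0,a_1,a_2,\dots)$ be a sequence with $a_k\in\{0,1\}=\mathbb{F}_2$ for all $k\ge 0$, and let $\Psi(\boldsymbol{\alpha})=(|a_1-a_0|,|a_2-a_1|,|a_3-a_2|,\dots)$ be the next row of the Proth–Gilbreath triangle generated by $\boldsymbol{\alpha}$. Let $\phi(\boldsymbol{\alpha})=\sum_{k\ge 0}a_kX^k\in\mathbb{F}_2[[X]]$. Then $\boldsymbol{\alpha}$ is ultimately replicated identically in $\Psi(\boldsymbol{\alpha})$ if and only if there exist an integer $r\ge 0$ and a polynomial $P(X)\in\mathbb{F}_2[X]$ such that either $$\phi(\boldsymbol{\alpha})=\frac{P(X)}{1+X+X^r}\qquad\text{or}\qquad \phi(\boldsymbol{\alpha})=\frac{P(X)}{X^r(1+X)+1}.$$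
   Context: The Proth–Gilbreath (PG) operator $\Psi$ sends a sequence of non-negative integers $(a_0,a_1,\dots)$ to the sequence $(|a_1-a_0|,|a_2-a_1|,\dots)$ of absolute differences of consecutive terms; iterating it produces the rows of the Proth–Gilbreath triangle. For $0/1$ entries, $|a_{k+1}-a_k|=a_k+a_{k+1}$ computed in $\mathbb{F}_2$. A row $\boldsymbol{\beta}=(b_0,b_1,\dots)$ is "ultimately replicated identically" in a row $\boldsymbol{\gamma}=(c_0,c_1,\dots)$ if there exist integers $m,n\ge 0$ such that $b_{m+k}=c_{n+k}$ for all $k\ge 0$. An equality $\phi=P/D$ with $P,D\in\mathbb{F}_2[X]$ means $D(X)\phi=P(X)$ in $\mathbb{F}_2[[X]]$. -}

module Defs where

open import Data.Bool using (Bool; true; false; _∧_; _xor_)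
open import Data.Nat using (ℕ; zero; suc; _+_)
open import Data.List using (List; []; _∷_; replicate; _++_)
open import Data.Product using (∃; ∃-syntax; _×_)
open import Relation.Binary.PropositionalEquality using (_≡_)

-- F₂ is represented by Bool (false = 0, true = 1, _xor_ = +, _∧_ = *).

Seq : Set
Seq = ℕ → Bool

-- The Proth–Gilbreath operator: (Ψ a)ₖ = |a_{k+1} - a_k|, which for 0/1 entries
-- equals a_k + a_{k+1} in F₂.
Ψ : Seq → Seq
Ψ a k = a k xor a (suc k)

UltReplicated : Seq → Seq → Set
UltReplicated β γ = ∃[ m ] ∃[ n ] (∀ k → β (m + k) ≡ γ (n + k))

PowerSeries : Set
PowerSeries = ℕ → Bool

φ : Seq → PowerSeries
φ a = a

-- Polynomials over F₂: coefficient lists [p₀, p₁, …, p_d].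
Poly : Set
Poly = List Bool

_+P_ : Poly → Poly → Poly
[] +P q = q
(p ∷ ps) +P [] = p ∷ ps
(p ∷ ps) +P (q ∷ qs) = (p xor q) ∷ (ps +P qs)

Xpow : ℕ → Poly
Xpow r = replicate r false ++ (true ∷ [])

coeff : Poly → PowerSeries
coeff [] n = false
coeff (p ∷ ps) zero = p
coeff (p ∷ ps) (suc n) = coeff ps n

-- Product D(X)·f in F₂[[X]] of a polynomial and a power series:
-- (d + X·ds)·f has n-th coefficient d·fₙ + (ds·f)_{n-1}.
_·S_ : Poly → PowerSeries → PowerSeries
([] ·S f) n = false
((d ∷ ds) ·S f) zero = d ∧ f zero
((d ∷ ds) ·S f) (suc n) = (d ∧ f (suc n)) xor ((ds ·S f) n)

-- φ = P / D means D(X)·φ = P(X) in F₂[[X]].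
_≡_/_ : PowerSeries → Poly → Poly → Set
f ≡ P / D = ∀ n → (D ·S f) n ≡ coeff P n

den₁ : ℕ → Poly
den₁ r = (true ∷ true ∷ []) +P Xpow r

den₂ : ℕ → Poly
den₂ r = (Xpow r ++ (true ∷ [])) +P (true ∷ [])

-- Since (1 + X)φ(α) = α₀ + X φ(Ψ α), an identity α_{m+k} = (Ψ α)_{n+k} for all k is a
-- three-term recurrence holding from some index on: α_j = α_{j+d} + α_{j+d+1} when n = m + d,
-- and α_{j+d+1} = α_j + α_{j+1} when m = n + d + 1.  These say exactly that the coefficients
-- of (1 + X + X^{d+1}) φ(α), resp. (X^d (1 + X) + 1) φ(α), eventually vanish, i.e. that this
-- product is a polynomial P.

module Submission where

open import Defs
open import Algebra using (CommutativeRing)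
import Algebra.Properties.CommutativeSemigroup as CommutativeSemigroupProperties
open import Data.Bool using (true; false; _∧_; _xor_)
open import Data.Bool.Properties
  using (xor-comm; xor-identityʳ; xor-same; ∧-distribʳ-xor; xor-∧-commutativeRing)
open import Data.List using ([]; _∷_; replicate; _++_; length; applyUpTo)
open import Data.List.Properties using (++-assoc)
open import Data.Nat using (ℕ; zero; suc; _+_)
open import Data.Nat.Properties
  using (+-assoc; +-suc; +-commutativeSemigroup; ≤-<-connex; m≤n⇒∃[o]m+o≡n)
open import Data.Product using (∃-syntax; _,_)
open import Data.Product.Function.Dependent.Propositional using (congˡ)
open import Data.Sum using (_⊎_; inj₁; inj₂)
open import Data.Sum.Function.Propositional using (_⊎-cong_)
open import Function.Bundles using (_⇔_; mk⇔; Equivalence)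
open import Function.Construct.Symmetry using (⇔-sym)
open import Function.Related.Propositional using (module EquationalReasoning)
open import Relation.Binary.PropositionalEquality

open CommutativeSemigroupProperties +-commutativeSemigroup using (x∙yz≈y∙xz)
open CommutativeSemigroupProperties
  (CommutativeRing.+-commutativeSemigroup xor-∧-commutativeRing) using (interchange)

Eventually : (ℕ → Set) → Set
Eventually P = ∃[ N ] (∀ k → P (N + k))

Eventually-cong : ∀ {P Q : ℕ → Set} → (∀ n → P n ⇔ Q n) → Eventually P ⇔ Eventually Q
Eventually-cong P⇔Q = mk⇔
  (λ (N , h) → N , λ k → Equivalence.to (P⇔Q (N + k)) (h k))
  (λ (N , h) → N , λ k → Equivalence.from (P⇔Q (N + k)) (h k))

Eventually-shift : ∀ {P : ℕ → Set} c → Eventually (λ n → P (c + n)) ⇔ Eventually P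
Eventually-shift {P} c = mk⇔
  (λ (N , h) → c + N , λ k → subst P (sym (+-assoc c N k)) (h k))
  (λ (N , h) → N , λ k → subst P (x∙yz≈y∙xz N c k) (h (c + k)))

polynomial⇔eventually-zero : (g : PowerSeries) →
  (∃[ P ] (∀ n → g n ≡ coeff P n)) ⇔ Eventually (λ n → g n ≡ false)
polynomial⇔eventually-zero g = mk⇔
  (λ (P , g≡P) → length P , λ k → trans (g≡P (length P + k)) (coeff-beyond-length P k))
  (λ (N , h) → applyUpTo g N , coeff-applyUpTo N g h)
  where
  coeff-beyond-length : ∀ P k → coeff P (length P + k) ≡ false
  coeff-beyond-length []      k = refl
  coeff-beyond-length (p ∷ P) k = coeff-beyond-length P k

  coeff-applyUpTo : ∀ N (g : PowerSeries) → (∀ k → g (N + k) ≡ false) →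
                    ∀ n → g n ≡ coeff (applyUpTo g N) n
  coeff-applyUpTo zero    g h n       = h n
  coeff-applyUpTo (suc N) g h zero    = refl
  coeff-applyUpTo (suc N) g h (suc n) = coeff-applyUpTo N (λ m → g (suc m)) h n

ultReplicated⇔ : ∀ {β γ : Seq} → UltReplicated β γ ⇔
  (∃[ d ] (Eventually (λ j → β j ≡ γ (d + j)) ⊎ Eventually (λ j → β (suc d + j) ≡ γ j)))
ultReplicated⇔ {β} {γ} = mk⇔ to from
  where
  Shifted : ℕ → Set
  Shifted d = Eventually (λ j → β j ≡ γ (d + j)) ⊎ Eventually (λ j → β (suc d + j) ≡ γ j)

  reassoc : ∀ m d k → m + d + k ≡ d + (m + k)
  reassoc m d k = trans (+-assoc m d k) (x∙yz≈y∙xz m d k)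

  to : UltReplicated β γ → ∃[ d ] Shifted d
  to (m , n , h) with ≤-<-connex m n
  ... | inj₁ m≤n with m≤n⇒∃[o]m+o≡n m≤n
  ...   | d , refl = d , inj₁ (m , λ k → trans (h k) (cong γ (reassoc m d k)))
  to (m , n , h) | inj₂ n<m with m≤n⇒∃[o]m+o≡n n<m
  ...   | d , refl = d , inj₂ (n , λ k → trans (cong β (sym (cong suc (reassoc n d k)))) (h k))

  from : ∃[ d ] Shifted d → UltReplicated β γ
  from (d , inj₁ (N , h)) = N , d + N , λ k → trans (h k) (cong γ (sym (+-assoc d N k)))
  from (d , inj₂ (N , h)) = suc d + N , N , λ k → trans (cong β (+-assoc (suc d) N k)) (h k)

·S-distrib-+P : ∀ p q (f : PowerSeries) n → ((p +P q) ·S f) n ≡ (p ·S f) n xor (q ·S f) n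
·S-distrib-+P []       q        f n       = refl
·S-distrib-+P (p ∷ ps) []       f n       = sym (xor-identityʳ _)
·S-distrib-+P (p ∷ ps) (q ∷ qs) f zero    = ∧-distribʳ-xor (f zero) p q
·S-distrib-+P (p ∷ ps) (q ∷ qs) f (suc n) = begin
  ((p xor q) ∧ f (suc n)) xor ((ps +P qs) ·S f) n
    ≡⟨ cong₂ _xor_ (∧-distribʳ-xor (f (suc n)) p q) (·S-distrib-+P ps qs f n) ⟩
  ((p ∧ f (suc n)) xor (q ∧ f (suc n))) xor ((ps ·S f) n xor (qs ·S f) n)
    ≡⟨ interchange (p ∧ f (suc n)) (q ∧ f (suc n)) ((ps ·S f) n) ((qs ·S f) n) ⟩
  ((p ∧ f (suc n)) xor (ps ·S f) n) xor ((q ∧ f (suc n)) xor (qs ·S f) n) ∎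
  where open ≡-Reasoning

·S-shift : ∀ k ds (f : PowerSeries) n → ((replicate k false ++ ds) ·S f) (k + n) ≡ (ds ·S f) n
·S-shift zero    ds f n = refl
·S-shift (suc k) ds f n = ·S-shift k ds f n

1·S : ∀ (f : PowerSeries) n → ((true ∷ []) ·S f) n ≡ f n
1·S f zero    = refl
1·S f (suc n) = xor-identityʳ (f (suc n))

Xpow·S : ∀ r (f : PowerSeries) n → (Xpow r ·S f) (r + n) ≡ f n
Xpow·S r f n = trans (·S-shift r (true ∷ []) f n) (1·S f n)

[1+X]·S : ∀ (f : PowerSeries) n → ((true ∷ true ∷ []) ·S f) (suc n) ≡ Ψ f n
[1+X]·S f n = trans (cong (f (suc n) xor_) (1·S f n)) (xor-comm (f (suc n)) (f n))

Xpow[1+X]·S : ∀ r (f : PowerSeries) n → ((Xpow r ++ true ∷ []) ·S f) (suc r + n) ≡ Ψ f n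
Xpow[1+X]·S r f n = begin
  ((Xpow r ++ true ∷ []) ·S f) (suc r + n)
    ≡⟨ cong₂ (λ D i → (D ·S f) i) (++-assoc (replicate r false) _ _) (sym (+-suc r n)) ⟩
  ((replicate r false ++ true ∷ true ∷ []) ·S f) (r + suc n)
    ≡⟨ ·S-shift r _ f (suc n) ⟩
  ((true ∷ true ∷ []) ·S f) (suc n)
    ≡⟨ [1+X]·S f n ⟩
  Ψ f n ∎
  where open ≡-Reasoning

den₁·S : ∀ d (f : PowerSeries) j → (den₁ (suc d) ·S f) (suc d + j) ≡ f j xor Ψ f (d + j)
den₁·S d f j = begin
  (den₁ (suc d) ·S f) (suc d + j)
    ≡⟨ ·S-distrib-+P (true ∷ true ∷ []) (Xpow (suc d)) f (suc d + j) ⟩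
  ((true ∷ true ∷ []) ·S f) (suc (d + j)) xor (Xpow (suc d) ·S f) (suc d + j)
    ≡⟨ cong₂ _xor_ ([1+X]·S f (d + j)) (Xpow·S (suc d) f j) ⟩
  Ψ f (d + j) xor f j
    ≡⟨ xor-comm (Ψ f (d + j)) (f j) ⟩
  f j xor Ψ f (d + j) ∎
  where open ≡-Reasoning

den₂·S : ∀ r (f : PowerSeries) j → (den₂ r ·S f) (suc r + j) ≡ f (suc r + j) xor Ψ f j
den₂·S r f j = begin
  (den₂ r ·S f) (suc r + j)
    ≡⟨ ·S-distrib-+P (Xpow r ++ true ∷ []) (true ∷ []) f (suc r + j) ⟩
  ((Xpow r ++ true ∷ []) ·S f) (suc r + j) xor ((true ∷ []) ·S f) (suc r + j)
    ≡⟨ cong₂ _xor_ (Xpow[1+X]·S r f j) (1·S f (suc r + j)) ⟩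
  Ψ f j xor f (suc r + j)
    ≡⟨ xor-comm (Ψ f j) (f (suc r + j)) ⟩
  f (suc r + j) xor Ψ f j ∎
  where open ≡-Reasoning

xor≡false⇔≡ : ∀ a b → (a xor b ≡ false) ⇔ (a ≡ b)
xor≡false⇔≡ a b = mk⇔ (to a b) λ { refl → xor-same a }
  where
  to : ∀ a b → a xor b ≡ false → a ≡ b
  to false b    eq = sym eq
  to true  true _  = refl

module _ (α : Seq) (d : ℕ) where
  open EquationalReasoning

  den₁-recurrence⇔ : ∀ j → (α j ≡ Ψ α (d + j)) ⇔ ((den₁ (suc d) ·S α) (suc d + j) ≡ false)
  den₁-recurrence⇔ j rewrite den₁·S d α j = ⇔-sym (xor≡false⇔≡ (α j) (Ψ α (d + j)))

  den₂-recurrence⇔ : ∀ j → (α (suc d + j) ≡ Ψ α j) ⇔ ((den₂ d ·S α) (suc d + j) ≡ false)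
  den₂-recurrence⇔ j rewrite den₂·S d α j = ⇔-sym (xor≡false⇔≡ (α (suc d + j)) (Ψ α j))

  eventual-recurrence⇔den₁ :
    Eventually (λ j → α j ≡ Ψ α (d + j)) ⇔ (∃[ P ] (α ≡ P / den₁ (suc d)))
  eventual-recurrence⇔den₁ = begin
    Eventually (λ j → α j ≡ Ψ α (d + j))
      ∼⟨ Eventually-cong den₁-recurrence⇔ ⟩
    Eventually (λ j → (den₁ (suc d) ·S α) (suc d + j) ≡ false)
      ∼⟨ Eventually-shift {λ n → (den₁ (suc d) ·S α) n ≡ false} (suc d) ⟩
    Eventually (λ n → (den₁ (suc d) ·S α) n ≡ false)
      ∼⟨ ⇔-sym (polynomial⇔eventually-zero (den₁ (suc d) ·S α)) ⟩
    (∃[ P ] (α ≡ P / den₁ (suc d))) ∎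

  eventual-recurrence⇔den₂ :
    Eventually (λ j → α (suc d + j) ≡ Ψ α j) ⇔ (∃[ P ] (α ≡ P / den₂ d))
  eventual-recurrence⇔den₂ = begin
    Eventually (λ j → α (suc d + j) ≡ Ψ α j)
      ∼⟨ Eventually-cong den₂-recurrence⇔ ⟩
    Eventually (λ j → (den₂ d ·S α) (suc d + j) ≡ false)
      ∼⟨ Eventually-shift {λ n → (den₂ d ·S α) n ≡ false} (suc d) ⟩
    Eventually (λ n → (den₂ d ·S α) n ≡ false)
      ∼⟨ ⇔-sym (polynomial⇔eventually-zero (den₂ d ·S α)) ⟩
    (∃[ P ] (α ≡ P / den₂ d)) ∎

-- den₁ 0 and den₂ 0 both equal X, so the case r = 0 of den₁ is covered by den₂.
den₁-suc-or-den₂⇔ : ∀ (f : PowerSeries) →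
  (∃[ d ] ((∃[ P ] (f ≡ P / den₁ (suc d))) ⊎ (∃[ P ] (f ≡ P / den₂ d)))) ⇔
  (∃[ r ] ∃[ P ] ((f ≡ P / den₁ r) ⊎ (f ≡ P / den₂ r)))
den₁-suc-or-den₂⇔ f = mk⇔ to from
  where
  to : ∃[ d ] ((∃[ P ] (f ≡ P / den₁ (suc d))) ⊎ (∃[ P ] (f ≡ P / den₂ d))) →
       ∃[ r ] ∃[ P ] ((f ≡ P / den₁ r) ⊎ (f ≡ P / den₂ r))
  to (d , inj₁ (P , p)) = suc d , P , inj₁ p
  to (d , inj₂ (P , p)) = d , P , inj₂ p

  from : ∃[ r ] ∃[ P ] ((f ≡ P / den₁ r) ⊎ (f ≡ P / den₂ r)) →
         ∃[ d ] ((∃[ P ] (f ≡ P / den₁ (suc d))) ⊎ (∃[ P ] (f ≡ P / den₂ d)))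
  from (zero  , P , inj₁ p) = zero , inj₂ (P , p)
  from (suc d , P , inj₁ p) = d , inj₁ (P , p)
  from (r     , P , inj₂ p) = r , inj₂ (P , p)

theorem2 : (α : Seq) →
    UltReplicated α (Ψ α) ⇔
      (∃[ r ] ∃[ P ] ((φ α ≡ P / den₁ r) ⊎ (φ α ≡ P / den₂ r)))
theorem2 α = begin
  UltReplicated α (Ψ α)
    ∼⟨ ultReplicated⇔ {α} {Ψ α} ⟩
  (∃[ d ] (Eventually (λ j → α j ≡ Ψ α (d + j)) ⊎ Eventually (λ j → α (suc d + j) ≡ Ψ α j)))
    ∼⟨ congˡ (λ {d} → eventual-recurrence⇔den₁ α d ⊎-cong eventual-recurrence⇔den₂ α d) ⟩
  (∃[ d ] ((∃[ P ] (α ≡ P / den₁ (suc d))) ⊎ (∃[ P ] (α ≡ P / den₂ d))))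
    ∼⟨ den₁-suc-or-den₂⇔ α ⟩
  (∃[ r ] ∃[ P ] ((φ α ≡ P / den₁ r) ⊎ (φ α ≡ P / den₂ r))) ∎
  where open EquationalReasoning
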